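{- Let $G$ be a finite simple graph with connected components $B_1,\dots,B_k$. Then \[ \varphi(G)=\sum_{i=1}^k\varphi(B_i)-(k-1). \]
   Context: Two sets overlap if they intersect and neither is a subset of the other. An overlap representation of a graph $G=(V,E)$ is a family (multiset) of sets $\{S_v : v\in V\}$ such that for all $u,v\in V$, $(u,v)\in E$ iff $S_u\cap S_v\neq\emptyset$, $S_u\not\subseteq S_v$ and $S_v\not\subseteq S_u$; its size is $|\bigcup_{v} S_v|$, and the overlap number $\varphi(G)$ is the minimum size of an overlap representation of $G$.
   Formalization: In an overlap representation every set $S_v$ is nonempty, so $\varphi(G)$ and each $\varphi(B_i)$ are minima over families of nonempty sets only. The statement above fails without it. -}

module Defs where

open import Data.Bool using (Bool; T)
open import Data.Nat using (ℕ; _≤_; _<_)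
open import Data.Fin using (Fin)
open import Data.Fin.Subset using (Subset; _∩_; _⊆_; Nonempty; ⋃; ∣_∣)
open import Data.List using (List; tabulate)
open import Data.Nat.ListAction using (sum)
open import Data.Product using (Σ; ∃; _×_)
open import Function.Bundles using (_⇔_)
open import Function.Definitions using (Injective)
open import Relation.Nullary using (¬_)
open import Relation.Binary.PropositionalEquality using (_≡_)
open import Relation.Binary.Construct.Closure.ReflexiveTransitive using (Star)

record Graph (n : ℕ) : Set where
  field
    adj   : Fin n → Fin n → Bool
    sym   : ∀ u v → adj u v ≡ adj v u
    irrefl : ∀ v → ¬ T (adj v v)

open Graph public

Edge : ∀ {n} → Graph n → Fin n → Fin n → Set
Edge G u v = T (adj G u v)

Overlap : ∀ {m} → Subset m → Subset m → Set
Overlap A B = Nonempty (A ∩ B) × ¬ (A ⊆ B) × ¬ (B ⊆ A)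

IsOverlapRep : ∀ {n m} → Graph n → (Fin n → Subset m) → Set
IsOverlapRep G S =
  (∀ v → Nonempty (S v)) ×
  (∀ u v → Edge G u v ⇔ Overlap (S u) (S v))

repSize : ∀ {n m} → (Fin n → Subset m) → ℕ
repSize S = ∣ ⋃ (tabulate S) ∣

IsOverlapNumber : ∀ {n} → Graph n → ℕ → Set
IsOverlapNumber {n} G p =
  (Σ ℕ λ m → Σ (Fin n → Subset m) λ S → IsOverlapRep G S × repSize S ≡ p) ×
  (∀ m (S : Fin n → Subset m) → IsOverlapRep G S → p ≤ repSize S)

induced : ∀ {n n'} → (G : Graph n) → (e : Fin n' → Fin n) → Graph n'
induced G e = record
  { adj = λ a b → adj G (e a) (e b)
  ; sym = λ a b → sym G (e a) (e b)
  ; irrefl = λ a → irrefl G (e a)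
  }

Connected : ∀ {n} → Graph n → Fin n → Fin n → Set
Connected G = Star (Edge G)

record Components {n} (G : Graph n) : Set where
  field
    k      : ℕ
    sz     : Fin k → ℕ
    emb    : (i : Fin k) → Fin (sz i) → Fin n
    nonempty : ∀ i → 0 < sz i
    emb-inj  : ∀ i → Injective _≡_ _≡_ (emb i)
    cover    : ∀ v → Σ (Fin k) λ i → Σ (Fin (sz i)) λ a → emb i a ≡ v
    same     : ∀ i j (a : Fin (sz i)) (b : Fin (sz j)) →
               Connected G (emb i a) (emb j b) ⇔ (i ≡ j)

  block : (i : Fin k) → Graph (sz i)
  block i = induced G (emb i)

open Components public

sumFin : ∀ {k} → (Fin k → ℕ) → ℕ
sumFin q = sum (tabulate q)

-- Sets representing vertices of different components never overlap, so any two of them are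
-- nested or disjoint.  For the lower bound, let U i be the union of the sets of component i and
-- choose i with ∣ U i ∣ least, ties going to components with at least two vertices.  Every set of
-- another component then contains U i or avoids it, so removing all but one point of U i from
-- those sets still represents the other components, while U i carries a representation of B i
-- and so has at least φ(B i) points; induction on the number of components gives at least
-- 1 + Σ (φ(B i) − 1) points.  For the upper bound, optimal representations of the components
-- are glued along a chain: one point of the universe of B 1 is replaced by the whole universe of
-- B 2 , … , B k (glued recursively), so a set of B 1 contains or avoids every later set; this uses
-- exactly 1 + Σ (φ(B i) − 1) points.
module Submission where

open import Data.Bool using (true; false; T)
open import Data.Bool.Properties using (T?)
open import Data.Empty using (⊥-elim)
open import Data.Fin using (Fin; zero; suc; _↑ˡ_; _↑ʳ_; splitAt; combine; fromℕ<)
open import Data.Fin.Properties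
  using (any?; all?; combine-injective; splitAt-↑ˡ; splitAt-↑ʳ) renaming (_≟_ to _≟ᶠ_)
open import Data.Fin.Subset
open import Data.Fin.Subset.Properties
open import Data.Fin.Subset.Induction using (⊂-wellFounded; Acc; acc)
import Data.List as List
open import Data.Nat using (ℕ; zero; suc; _+_; _*_; _∸_; pred; _≤_; _<_; z≤n; s≤s)
open import Data.Nat.Properties
open import Algebra.Properties.CommutativeSemigroup +-commutativeSemigroup using (x∙yz≈y∙xz)
open import Data.Product using (Σ; ∃; _×_; _,_; proj₁; proj₂; map; map₁; map₂; swap)
open import Data.Sum using (_⊎_; inj₁; inj₂; [_,_]′; reduce)
open import Data.Vec using (Vec; []; _∷_; _++_; here; there; lookup; tabulate)
open import Data.Vec.Properties using ([]=⇒lookup; lookup⇒[]=; lookup∘tabulate; lookup-++ˡ; lookup-++ʳ)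
open import Function using (_∘_; id)
open import Function.Bundles using (_⇔_; mk⇔; Equivalence)
open import Function.Construct.Composition using (_⇔-∘_)
open import Relation.Nullary using (¬_; Dec; yes; no; does; ¬?)
open import Relation.Nullary.Decidable using (_×-dec_; _⊎-dec_; _→-dec_; map′)
open import Relation.Unary using (Decidable)
open import Relation.Binary.PropositionalEquality
open import Relation.Binary.Construct.Closure.ReflexiveTransitive using (ε; _◅_)
open import Defs hiding (sym)

open Equivalence using (to; from)

∃-least : {Q : ℕ → Set} → (∀ p → Dec (Q p)) → ∃ Q → ∃ λ p → Q p × (∀ {p′} → Q p′ → p ≤ p′)
∃-least {Q} Q? (b , qb) = [ (λ least → least) , (λ b< → ⊥-elim (n≮n b (b< qb))) ]′ (below (suc b))
  where
  below : ∀ b → (∃ λ p → Q p × (∀ {p′} → Q p′ → p ≤ p′)) ⊎ (∀ {p′} → Q p′ → b ≤ p′)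
  below zero = inj₂ (λ _ → z≤n)
  below (suc b) with below b
  ... | inj₁ least = inj₁ least
  ... | inj₂ b≤ with Q? b
  ...   | yes qb = inj₁ (b , qb , b≤)
  ...   | no ¬qb = inj₂ λ qp → ≤∧≢⇒< (b≤ qp) λ { refl → ¬qb qp }

argmin : ∀ {k} (f : Fin k → ℕ) {K : Subset k} → Nonempty K →
         ∃ λ i → i ∈ K × (∀ {j} → j ∈ K → f i ≤ f j)
argmin f {K} (j , j∈K)
  with ∃-least (λ t → any? λ i → (i ∈? K) ×-dec (f i ≟ t)) (f j , j , j∈K , refl)
... | _ , (i , i∈K , refl) , least = i , i∈K , λ j∈K → least (_ , j∈K , refl)

∈⇔lookup : ∀ {m} {x : Fin m} {p : Subset m} → x ∈ p ⇔ lookup p x ≡ inside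
∈⇔lookup = mk⇔ []=⇒lookup (lookup⇒[]= _ _)

∈-lookup-cong : ∀ {m m′} {x : Fin m} {x′ : Fin m′} {p p′} →
                lookup p x ≡ lookup p′ x′ → x ∈ p ⇔ x′ ∈ p′
∈-lookup-cong eq = mk⇔ (λ x∈p → from ∈⇔lookup (trans (sym eq) (to ∈⇔lookup x∈p)))
                       (λ x′∈p′ → from ∈⇔lookup (trans eq (to ∈⇔lookup x′∈p′)))

toSubset : ∀ {m} {P : Fin m → Set} → Decidable P → Subset m
toSubset P? = tabulate (does ∘ P?)

∈-toSubset : ∀ {m} {P : Fin m → Set} (P? : Decidable P) {x} → x ∈ toSubset P? ⇔ P x
∈-toSubset {P = P} P? {x} =
  reflects (P? x) ⇔-∘ subst (λ b → x ∈ toSubset P? ⇔ b ≡ inside) (lookup∘tabulate (does ∘ P?) x) ∈⇔lookup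
  where
  reflects : (d : Dec (P x)) → does d ≡ inside ⇔ P x
  reflects (yes p) = mk⇔ (λ _ → p) (λ _ → refl)
  reflects (no ¬p) = mk⇔ (λ ()) (⊥-elim ∘ ¬p)

_⁻¹[_] : ∀ {s m} → (Fin s → Fin m) → Subset m → Subset s
g ⁻¹[ A ] = tabulate (lookup A ∘ g)

∈-⁻¹ : ∀ {s m} (g : Fin s → Fin m) {A y} → y ∈ g ⁻¹[ A ] ⇔ g y ∈ A
∈-⁻¹ g {A} {y} = ∈-lookup-cong (lookup∘tabulate (lookup A ∘ g) y)

x∈⋃⁺ : ∀ {n m} (S : Fin n → Subset m) {x} v → x ∈ S v → x ∈ ⋃ (List.tabulate S)
x∈⋃⁺ S zero    x∈S = x∈p∪q⁺ (inj₁ x∈S)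
x∈⋃⁺ S (suc v) x∈S = x∈p∪q⁺ (inj₂ (x∈⋃⁺ (S ∘ suc) v x∈S))

x∈⋃⁻ : ∀ {n m} (S : Fin n → Subset m) {x} → x ∈ ⋃ (List.tabulate S) → ∃ λ v → x ∈ S v
x∈⋃⁻ {zero}  S x∈⋃ = ⊥-elim (∉⊥ x∈⋃)
x∈⋃⁻ {suc n} S x∈⋃ with x∈p∪q⁻ (S zero) _ x∈⋃
... | inj₁ x∈S₀ = zero , x∈S₀
... | inj₂ x∈⋃′ = map suc id (x∈⋃⁻ (S ∘ suc) x∈⋃′)

Covers : ∀ {n m} → (Fin n → Subset m) → Set
Covers S = ∀ x → ∃ λ v → x ∈ S v

Covers⇒repSize≡ : ∀ {n m} (S : Fin n → Subset m) → Covers S → repSize S ≡ m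
Covers⇒repSize≡ {m = m} S covers =
  trans (cong ∣_∣ (⊆-antisym ⊆⊤ λ {x} _ → x∈⋃⁺ S (proj₁ (covers x)) (proj₂ (covers x)))) (∣⊤∣≡n m)

∣p∪q∣+∣p∩q∣≡∣p∣+∣q∣ : ∀ {m} (p q : Subset m) → ∣ p ∪ q ∣ + ∣ p ∩ q ∣ ≡ ∣ p ∣ + ∣ q ∣
∣p∪q∣+∣p∩q∣≡∣p∣+∣q∣ []          []          = refl
∣p∪q∣+∣p∩q∣≡∣p∣+∣q∣ (true ∷ p)  (true ∷ q)  = cong suc (begin
  ∣ p ∪ q ∣ + suc ∣ p ∩ q ∣    ≡⟨ +-suc _ _ ⟩
  suc (∣ p ∪ q ∣ + ∣ p ∩ q ∣)  ≡⟨ cong suc (∣p∪q∣+∣p∩q∣≡∣p∣+∣q∣ p q) ⟩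
  suc (∣ p ∣ + ∣ q ∣)          ≡⟨ +-suc _ _ ⟨
  ∣ p ∣ + suc ∣ q ∣            ∎)
  where open ≡-Reasoning
∣p∪q∣+∣p∩q∣≡∣p∣+∣q∣ (true ∷ p)  (false ∷ q) = cong suc (∣p∪q∣+∣p∩q∣≡∣p∣+∣q∣ p q)
∣p∪q∣+∣p∩q∣≡∣p∣+∣q∣ (false ∷ p) (true ∷ q)  = trans (cong suc (∣p∪q∣+∣p∩q∣≡∣p∣+∣q∣ p q)) (sym (+-suc _ _))
∣p∪q∣+∣p∩q∣≡∣p∣+∣q∣ (false ∷ p) (false ∷ q) = ∣p∪q∣+∣p∩q∣≡∣p∣+∣q∣ p q

disjoint⇒∣p∣+∣q∣≤∣r∣ : ∀ {m} {p q r : Subset m} → Empty (p ∩ q) → p ⊆ r → q ⊆ r → ∣ p ∣ + ∣ q ∣ ≤ ∣ r ∣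
disjoint⇒∣p∣+∣q∣≤∣r∣ {m} {p} {q} {r} p∩q≡∅ p⊆r q⊆r = begin
  ∣ p ∣ + ∣ q ∣          ≡⟨ ∣p∪q∣+∣p∩q∣≡∣p∣+∣q∣ p q ⟨
  ∣ p ∪ q ∣ + ∣ p ∩ q ∣  ≡⟨ cong (λ s → ∣ p ∪ q ∣ + ∣ s ∣) (Empty-unique p∩q≡∅) ⟩
  ∣ p ∪ q ∣ + ∣ ⊥ {m} ∣  ≡⟨ cong (∣ p ∪ q ∣ +_) (∣⊥∣≡0 m) ⟩
  ∣ p ∪ q ∣ + 0          ≡⟨ +-identityʳ _ ⟩
  ∣ p ∪ q ∣              ≤⟨ p⊆q⇒∣p∣≤∣q∣ (λ x∈p∪q → [ p⊆r , q⊆r ]′ (x∈p∪q⁻ p q x∈p∪q)) ⟩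
  ∣ r ∣                  ∎
  where open ≤-Reasoning

x∈p⇒∣p∣≡1+∣p-x∣ : ∀ {m} {p : Subset m} {x} → x ∈ p → ∣ p ∣ ≡ suc ∣ p - x ∣
x∈p⇒∣p∣≡1+∣p-x∣ {p = true ∷ p}  here        = cong (suc ∘ ∣_∣) (sym (p─⊥≡p p))
x∈p⇒∣p∣≡1+∣p-x∣ {p = true ∷ p}  (there x∈p) = cong suc (x∈p⇒∣p∣≡1+∣p-x∣ x∈p)
x∈p⇒∣p∣≡1+∣p-x∣ {p = false ∷ p} (there x∈p) = x∈p⇒∣p∣≡1+∣p-x∣ x∈p

p⊆q∧∣q∣≤∣p∣⇒q⊆p : ∀ {m} {p q : Subset m} → p ⊆ q → ∣ q ∣ ≤ ∣ p ∣ → q ⊆ p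
p⊆q∧∣q∣≤∣p∣⇒q⊆p {p = p} {q} p⊆q ∣q∣≤∣p∣ {x} x∈q with x ∈? p
... | yes x∈p = x∈p
... | no  x∉p = ⊥-elim (<⇒≱ (≤-<-trans (p⊆q⇒∣p∣≤∣q∣ p⊆q-x) (x∈p⇒∣p-x∣<∣p∣ x∈q)) ∣q∣≤∣p∣)
  where
  p⊆q-x : p ⊆ q - x
  p⊆q-x y∈p = x∈p∧x≢y⇒x∈p-y (p⊆q y∈p) λ { refl → x∉p y∈p }

x∈p─q⇒x∉q : ∀ {m} {p q : Subset m} {x} → x ∈ p ─ q → x ∉ q
x∈p─q⇒x∉q {p = _ ∷ p} {true ∷ q} {zero}  () here
x∈p─q⇒x∉q {p = _ ∷ p} {_ ∷ q}    {suc x} (there x∈p─q) (there x∈q) = x∈p─q⇒x∉q {p = p} x∈p─q x∈q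

enumerate : ∀ {m} (p : Subset m) → Fin ∣ p ∣ → Fin m
enumerate (true ∷ p)  zero    = zero
enumerate (true ∷ p)  (suc y) = suc (enumerate p y)
enumerate (false ∷ p) y       = suc (enumerate p y)

enumerate-∈ : ∀ {m} (p : Subset m) y → enumerate p y ∈ p
enumerate-∈ (true ∷ p)  zero    = here
enumerate-∈ (true ∷ p)  (suc y) = there (enumerate-∈ p y)
enumerate-∈ (false ∷ p) y       = there (enumerate-∈ p y)

enumerate-onto : ∀ {m} (p : Subset m) {x} → x ∈ p → ∃ λ y → enumerate p y ≡ x
enumerate-onto (true ∷ p)  here        = zero , refl
enumerate-onto (true ∷ p)  (there x∈p) with enumerate-onto p x∈p
... | y , refl = suc y , refl
enumerate-onto (false ∷ p) (there x∈p) with enumerate-onto p x∈p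
... | y , refl = y , refl

sumOver : ∀ {k} → Subset k → (Fin k → ℕ) → ℕ
sumOver []          f = 0
sumOver (true ∷ K)  f = f zero + sumOver K (f ∘ suc)
sumOver (false ∷ K) f = sumOver K (f ∘ suc)

sumOver-⊤ : ∀ {k} (f : Fin k → ℕ) → sumOver ⊤ f ≡ sumFin f
sumOver-⊤ {zero}  f = refl
sumOver-⊤ {suc k} f = cong (f zero +_) (sumOver-⊤ (f ∘ suc))

sumOver-⊥ : ∀ {k} (f : Fin k → ℕ) → sumOver ⊥ f ≡ 0
sumOver-⊥ {zero}  f = refl
sumOver-⊥ {suc k} f = sumOver-⊥ (f ∘ suc)

sumOver-remove : ∀ {k} {K : Subset k} (f : Fin k → ℕ) {i} → i ∈ K → sumOver K f ≡ f i + sumOver (K - i) f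
sumOver-remove {K = true ∷ K}  f         here        = cong (λ K′ → f zero + sumOver K′ (f ∘ suc)) (sym (p─⊥≡p K))
sumOver-remove {K = true ∷ K}  f {suc i} (there i∈K) =
  trans (cong (f zero +_) (sumOver-remove (f ∘ suc) i∈K)) (x∙yz≈y∙xz (f zero) (f (suc i)) _)
sumOver-remove {K = false ∷ K} f         (there i∈K) = sumOver-remove (f ∘ suc) i∈K

-- Pairs of sets with the same intersection pattern

record Alike {m m′} (A B : Subset m) (A′ B′ : Subset m′) : Set where
  field
    meet : Nonempty (A ∩ B) ⇔ Nonempty (A′ ∩ B′)
    incl : A ⊆ B ⇔ A′ ⊆ B′

open Alike

Alike-refl : ∀ {m} {A B : Subset m} → Alike A B A B
Alike-refl = record { meet = mk⇔ id id ; incl = mk⇔ id id }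

Alike-trans : ∀ {m m′ m″} {A B : Subset m} {A′ B′ : Subset m′} {A″ B″ : Subset m″} →
              Alike A B A′ B′ → Alike A′ B′ A″ B″ → Alike A B A″ B″
Alike-trans AB A′B′ = record { meet = meet A′B′ ⇔-∘ meet AB ; incl = incl A′B′ ⇔-∘ incl AB }

Alike⇒Nonempty : ∀ {m m′} {A : Subset m} {A′ : Subset m′} → Alike A A A′ A′ → Nonempty A → Nonempty A′
Alike⇒Nonempty {A = A} {A′} AA = intersected⇒nonempty ∘ to (meet AA) ∘ map₂ (λ x∈A → x∈p∩q⁺ (x∈A , x∈A))
  where
  intersected⇒nonempty : Nonempty (A′ ∩ A′) → Nonempty A′
  intersected⇒nonempty = map₂ (proj₁ ∘ x∈p∩q⁻ A′ A′)

Overlap-cong : ∀ {m m′} {A B : Subset m} {A′ B′ : Subset m′} →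
               Alike A B A′ B′ → Alike B A B′ A′ → Overlap A B ⇔ Overlap A′ B′
Overlap-cong AB BA = mk⇔
  (λ (meets , A⊈B , B⊈A) → to (meet AB) meets , A⊈B ∘ from (incl AB) , B⊈A ∘ from (incl BA))
  (λ (meets , A⊈B , B⊈A) → from (meet AB) meets , A⊈B ∘ to (incl AB) , B⊈A ∘ to (incl BA))

Overlap-sym : ∀ {m} {A B : Subset m} → Overlap A B → Overlap B A
Overlap-sym {A = A} {B} ((z , z∈A∩B) , A⊈B , B⊈A) = (z , x∈p∩q⁺ (swap (x∈p∩q⁻ A B z∈A∩B))) , B⊈A , A⊈B

IsOverlapRep-cong : ∀ {n m m′} {G : Graph n} {S : Fin n → Subset m} {S′ : Fin n → Subset m′} →
                    (∀ u v → Alike (S u) (S v) (S′ u) (S′ v)) → IsOverlapRep G S → IsOverlapRep G S′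
IsOverlapRep-cong alike (nonempty , edge⇔overlap) =
  (λ v → Alike⇒Nonempty (alike v v) (nonempty v)) ,
  (λ u v → Overlap-cong (alike u v) (alike v u) ⇔-∘ edge⇔overlap u v)

Alike-pullback : ∀ {s m} (g : Fin s → Fin m) {A B : Subset m} {A′ B′ : Subset s} →
                 (∀ {y} → y ∈ A′ ⇔ g y ∈ A) → (∀ {y} → y ∈ B′ ⇔ g y ∈ B) →
                 (∀ {x} → x ∈ A → ∃ λ y → g y ≡ x) → Alike A B A′ B′
Alike-pullback g {A} {B} {A′} {B′} ∈A′ ∈B′ onto = record
  { meet = mk⇔ meet⁺ meet⁻
  ; incl = mk⇔ incl⁺ (λ A′⊆B′ x∈A → incl⁻ A′⊆B′ (onto x∈A) x∈A)
  }
  where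
  meet⁺ : Nonempty (A ∩ B) → Nonempty (A′ ∩ B′)
  meet⁺ (x , x∈A∩B) with x∈p∩q⁻ A B x∈A∩B
  ... | x∈A , x∈B with onto x∈A
  ...   | y , refl = y , x∈p∩q⁺ (from ∈A′ x∈A , from ∈B′ x∈B)
  meet⁻ : Nonempty (A′ ∩ B′) → Nonempty (A ∩ B)
  meet⁻ (y , y∈A′∩B′) = g y , x∈p∩q⁺ (map (to ∈A′) (to ∈B′) (x∈p∩q⁻ A′ B′ y∈A′∩B′))
  incl⁺ : A ⊆ B → A′ ⊆ B′
  incl⁺ A⊆B = from ∈B′ ∘ A⊆B ∘ to ∈A′
  incl⁻ : A′ ⊆ B′ → ∀ {x} → (∃ λ y → g y ≡ x) → x ∈ A → x ∈ B
  incl⁻ A′⊆B′ (y , refl) = to ∈B′ ∘ A′⊆B′ ∘ from ∈A′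

ContainsOrAvoids : ∀ {m} → Subset m → Subset m → Set
ContainsOrAvoids W A = W ⊆ A ⊎ (∀ {z} → z ∈ A → z ∉ W)

module _ {m} {W : Subset m} {x} (x∈W : x ∈ W) where

  private
    x∉W-x : x ∉ W - x
    x∉W-x x∈W-x = x∈p─q⇒x∉q {p = W} x∈W-x (x∈⁅x⁆ x)

    x∈A : ∀ {A z} → ContainsOrAvoids W A → z ∈ A → z ∈ W - x → x ∈ A
    x∈A (inj₁ W⊆A)   _   _     = W⊆A x∈W
    x∈A (inj₂ A∩W≡∅) z∈A z∈W-x = ⊥-elim (A∩W≡∅ z∈A (p─q⊆p W _ z∈W-x))

  Alike-─ : ∀ {A B} → ContainsOrAvoids W A → ContainsOrAvoids W B → Alike A B (A ─ (W - x)) (B ─ (W - x))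
  Alike-─ {A} {B} A-ok B-ok = record
    { meet = mk⇔ meet⁺ λ (z , z∈) → z , x∈p∩q⁺ (map (p─q⊆p A _) (p─q⊆p B _) (x∈p∩q⁻ _ _ z∈))
    ; incl = mk⇔ incl⁺ incl⁻
    }
    where
    meet⁺ : Nonempty (A ∩ B) → Nonempty ((A ─ (W - x)) ∩ (B ─ (W - x)))
    meet⁺ (z , z∈A∩B) with x∈p∩q⁻ A B z∈A∩B | z ∈? W - x
    ... | z∈A , z∈B | yes z∈W-x = x , x∈p∩q⁺ ( x∈p∧x∉q⇒x∈p─q (x∈A A-ok z∈A z∈W-x) x∉W-x
                                               , x∈p∧x∉q⇒x∈p─q (x∈A B-ok z∈B z∈W-x) x∉W-x )
    ... | z∈A , z∈B | no z∉W-x  = z , x∈p∩q⁺ (x∈p∧x∉q⇒x∈p─q z∈A z∉W-x , x∈p∧x∉q⇒x∈p─q z∈B z∉W-x)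
    incl⁺ : A ⊆ B → A ─ (W - x) ⊆ B ─ (W - x)
    incl⁺ A⊆B z∈ = x∈p∧x∉q⇒x∈p─q (A⊆B (p─q⊆p A _ z∈)) (x∈p─q⇒x∉q {p = A} z∈)
    incl⁻ : A ─ (W - x) ⊆ B ─ (W - x) → A ⊆ B
    incl⁻ ⊆′ {z} z∈A with z ∈? W - x
    ... | no z∉W-x  = p─q⊆p B _ (⊆′ (x∈p∧x∉q⇒x∈p─q z∈A z∉W-x))
    ... | yes z∈W-x = [ (λ W⊆B → W⊆B (p─q⊆p W _ z∈W-x)) , (λ B∩W≡∅ → ⊥-elim (B∩W≡∅ x∈B x∈W)) ]′ B-ok
      where x∈B = p─q⊆p B _ (⊆′ (x∈p∧x∉q⇒x∈p─q (x∈A A-ok z∈A z∈W-x) x∉W-x))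

-- Optimal representations exist

module _ {n} (H : Graph n) where

  private
    -- vertex u is represented by the pair (u , u) and the edges incident to u
    Incident : Fin n → Fin n → Fin n → Set
    Incident u a b = (a ≡ u ⊎ b ≡ u) × (a ≡ b ⊎ Edge H a b)

    incident? : ∀ u z → Dec (∃ λ a → ∃ λ b → combine a b ≡ z × Incident u a b)
    incident? u z = any? λ a → any? λ b →
      (combine a b ≟ᶠ z) ×-dec ((a ≟ᶠ u) ⊎-dec (b ≟ᶠ u)) ×-dec ((a ≟ᶠ b) ⊎-dec T? (adj H a b))

  incidenceSets : Fin n → Subset (n * n)
  incidenceSets u = toSubset (incident? u)

  private
    edge-sym : ∀ {u v} → Edge H u v → Edge H v u
    edge-sym {u} {v} = subst T (Graph.sym H u v)

    ∈-incidenceSets : ∀ {u a b} → combine a b ∈ incidenceSets u ⇔ Incident u a b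
    ∈-incidenceSets {u} {a} {b} = mk⇔ incident (λ i → from (∈-toSubset (incident? u)) (a , b , refl , i))
      where
      incident : combine a b ∈ incidenceSets u → Incident u a b
      incident ab∈ with to (∈-toSubset (incident? u)) ab∈
      ... | a′ , b′ , eq , i with combine-injective a′ b′ a b eq
      ...   | refl , refl = i

    shared⇒edge : ∀ {u v a b} → u ≢ v → Incident u a b → Incident v a b → Edge H u v
    shared⇒edge u≢v (u∈ab , inj₁ refl)   (v∈ab , _)       = ⊥-elim (u≢v (trans (sym (reduce u∈ab)) (reduce v∈ab)))
    shared⇒edge u≢v (inj₁ refl , inj₂ e) (inj₁ refl , _) = ⊥-elim (u≢v refl)
    shared⇒edge u≢v (inj₁ refl , inj₂ e) (inj₂ refl , _) = e
    shared⇒edge u≢v (inj₂ refl , inj₂ e) (inj₁ refl , _) = edge-sym e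
    shared⇒edge u≢v (inj₂ refl , inj₂ e) (inj₂ refl , _) = ⊥-elim (u≢v refl)

    loop∈ : ∀ u → combine u u ∈ incidenceSets u
    loop∈ u = from ∈-incidenceSets (inj₁ refl , inj₁ refl)

    loop∉ : ∀ {u v} → Edge H u v → combine u u ∉ incidenceSets v
    loop∉ {u} e uu∈ with reduce (proj₁ (to ∈-incidenceSets uu∈))
    ... | refl = Graph.irrefl H u e

    edge⇒overlap : ∀ {u v} → Edge H u v → Overlap (incidenceSets u) (incidenceSets v)
    edge⇒overlap e =
        (_ , x∈p∩q⁺ (from ∈-incidenceSets (inj₁ refl , inj₂ e) , from ∈-incidenceSets (inj₂ refl , inj₂ e)))
                   , (λ ⊆ → loop∉ e (⊆ (loop∈ _)))
                   , (λ ⊆ → loop∉ (edge-sym e) (⊆ (loop∈ _)))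

    overlap⇒edge : ∀ {u v} → Overlap (incidenceSets u) (incidenceSets v) → Edge H u v
    overlap⇒edge {u} ((z , z∈) , Su⊈Sv , _) with x∈p∩q⁻ (incidenceSets u) _ z∈
    ... | z∈Su , z∈Sv with to (∈-toSubset (incident? u)) z∈Su
    ...   | a , b , refl , i = shared⇒edge (λ { refl → Su⊈Sv (λ x∈ → x∈) }) i (to ∈-incidenceSets z∈Sv)

  incidenceSets-isRep : IsOverlapRep H incidenceSets
  incidenceSets-isRep = (λ v → _ , loop∈ v) , λ u v → mk⇔ edge⇒overlap overlap⇒edge

_⇔?_ : ∀ {A B : Set} → Dec A → Dec B → Dec (A ⇔ B)
A? ⇔? B? = map′ (λ (f , g) → mk⇔ f g) (λ e → to e , from e) ((A? →-dec B?) ×-dec (B? →-dec A?))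

Overlap? : ∀ {m} (A B : Subset m) → Dec (Overlap A B)
Overlap? A B = nonempty? (A ∩ B) ×-dec ¬? (A ⊆? B) ×-dec ¬? (B ⊆? A)

IsOverlapRep? : ∀ {n m} (H : Graph n) (S : Fin n → Subset m) → Dec (IsOverlapRep H S)
IsOverlapRep? H S = all? (nonempty? ∘ S) ×-dec all? λ u → all? λ v → T? (adj H u v) ⇔? Overlap? (S u) (S v)

∃-Vec? : ∀ {A : Set} → (∀ {P : A → Set} → (∀ a → Dec (P a)) → Dec (∃ P)) →
         ∀ n {P : Vec A n → Set} → (∀ as → Dec (P as)) → Dec (∃ P)
∃-Vec? ∃? zero    P? = map′ ([] ,_) (λ { ([] , p) → p }) (P? [])
∃-Vec? ∃? (suc n) P? = map′ (λ (a , as , p) → a ∷ as , p) (λ { (a ∷ as , p) → a , as , p })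
                            (∃? λ a → ∃-Vec? ∃? n λ as → P? (a ∷ as))

-- The sets are kept in a vector so that the existence of a tight representation is decidable.
TightRep : ∀ {n} → Graph n → ℕ → Set
TightRep {n} H m = ∃ λ (sets : Vec (Subset m) n) → IsOverlapRep H (lookup sets) × Covers (lookup sets)

TightRep? : ∀ {n} (H : Graph n) m → Dec (TightRep H m)
TightRep? {n} H m = ∃-Vec? anySubset? n λ sets →
  IsOverlapRep? H (lookup sets) ×-dec all? λ x → any? λ v → x ∈? lookup sets v

tighten : ∀ {n m} {H : Graph n} {S : Fin n → Subset m} → IsOverlapRep H S → TightRep H (repSize S)
tighten {H = H} {S} isRep =
  tabulate S′ ,
  IsOverlapRep-cong {G = H} (λ u v → Alike-pullback g (∈-S′ {u}) (∈-S′ {v}) (enumerate-onto _ ∘ x∈⋃⁺ S u)) isRep ,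
  λ y → map₂ (from ∈-S′) (x∈⋃⁻ S (enumerate-∈ _ y))
  where
  g = enumerate (⋃ (List.tabulate S))
  S′ = λ v → g ⁻¹[ S v ]
  ∈-S′ : ∀ {v y} → y ∈ lookup (tabulate S′) v ⇔ g y ∈ S v
  ∈-S′ {v} {y} = subst (λ A → y ∈ A ⇔ g y ∈ S v) (sym (lookup∘tabulate S′ v)) (∈-⁻¹ g)

record OptimalRep {n} (H : Graph n) : Set where
  field
    size    : ℕ
    sets    : Vec (Subset size) n
    isRep   : IsOverlapRep H (lookup sets)
    covers  : Covers (lookup sets)
    optimal : ∀ m (S : Fin n → Subset m) → IsOverlapRep H S → size ≤ repSize S

  isOverlapNumber : IsOverlapNumber H size
  isOverlapNumber = (size , lookup sets , isRep , Covers⇒repSize≡ (lookup sets) covers) , optimal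

optimalRep : ∀ {n} (H : Graph n) → OptimalRep H
optimalRep H with ∃-least (TightRep? H) (_ , tighten {H = H} (incidenceSets-isRep H))
... | size , (sets , isRep , covers) , least = record
  { size = size ; sets = sets ; isRep = isRep ; covers = covers ; optimal = λ _ _ → least ∘ tighten {H = H} }

Fin1-unique : ∀ {s} (a b : Fin s) → s ≡ 1 → a ≡ b
Fin1-unique zero zero refl = refl

anotherFin : ∀ {s} (a : Fin s) → s ≢ 1 → ∃ λ b → b ≢ a
anotherFin {suc zero}    zero    s≢1 = ⊥-elim (s≢1 refl)
anotherFin {suc (suc s)} zero    _   = suc zero , λ ()
anotherFin {suc (suc s)} (suc a) _   = zero , λ ()

module ComponentFacts {n} {G : Graph n} (C : Components G) where

  component : Fin n → Fin (k C)
  component v = proj₁ (cover C v)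

  position : (v : Fin n) → Fin (sz C (component v))
  position v = proj₁ (proj₂ (cover C v))

  emb-position : ∀ v → emb C (component v) (position v) ≡ v
  emb-position v = proj₂ (proj₂ (cover C v))

  Connected⇔≡ : ∀ {u v} → Connected G u v ⇔ component u ≡ component v
  Connected⇔≡ {u} {v} = subst₂ (λ u′ v′ → Connected G u′ v′ ⇔ component u ≡ component v)
                                (emb-position u) (emb-position v) (same C _ _ (position u) (position v))

  Edge⇒≡ : ∀ {u v} → Edge G u v → component u ≡ component v
  Edge⇒≡ e = to Connected⇔≡ (e ◅ ε)

  component-emb : ∀ i a → component (emb C i a) ≡ i
  component-emb i a = to (same C _ i (position w) a) (subst (λ w′ → Connected G w′ w) (sym (emb-position w)) ε)
    where w = emb C i a

  ∈-component : ∀ i a {K} → i ∈ K → component (emb C i a) ∈ K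
  ∈-component i a = subst (_∈ _) (sym (component-emb i a))

  position-emb : ∀ i a → (component (emb C i a) , position (emb C i a)) ≡ (i , a)
  position-emb i a = lemma (component-emb i a) (emb-position (emb C i a))
    where
    lemma : ∀ {j b} → j ≡ i → emb C j b ≡ emb C i a → (j , b) ≡ (i , a)
    lemma refl eq = cong (i ,_) (emb-inj C i eq)

  singleton : ∀ {u w} → component u ≡ component w → sz C (component w) ≡ 1 → u ≡ w
  singleton {u} {w} u~w size≡1 =
    trans (sym (emb-position u)) (trans (lemma (position u) (position w) u~w size≡1) (emb-position w))
    where
    lemma : ∀ {i j} (a : Fin (sz C i)) (b : Fin (sz C j)) → i ≡ j → sz C j ≡ 1 → emb C i a ≡ emb C j b
    lemma a b refl size≡1 = cong (emb C _) (Fin1-unique a b size≡1)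

  neighbour : ∀ u → sz C (component u) ≢ 1 → ∃ (Edge G u)
  neighbour u size≢1 with anotherFin (position u) size≢1
  ... | a , a≢ = firstStep (from Connected⇔≡ (sym (component-emb _ a))) u≢w
    where
    u≢w : u ≢ emb C (component u) a
    u≢w u≡w = a≢ (emb-inj C _ (trans (sym u≡w) (sym (emb-position u))))
    firstStep : ∀ {w} → Connected G u w → u ≢ w → ∃ (Edge G u)
    firstStep ε       u≢u = ⊥-elim (u≢u refl)
    firstStep (e ◅ _) _   = _ , e

-- The lower bound

tieBreak : ℕ → ℕ
tieBreak 1 = 1
tieBreak _ = 0

tieBreak≤1 : ∀ s → tieBreak s ≤ 1
tieBreak≤1 0             = z≤n
tieBreak≤1 1             = s≤s z≤n
tieBreak≤1 (suc (suc s)) = z≤n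

tieBreak-reflects-1 : ∀ {s t} → tieBreak s ≤ tieBreak t → s ≡ 1 → t ≡ 1
tieBreak-reflects-1 {t = 1}           _  _    = refl
tieBreak-reflects-1 {t = 0}           () refl
tieBreak-reflects-1 {t = suc (suc t)} () refl

2*m+s≤2*n+t⇒m≤n : ∀ {m n s t} → t ≤ 1 → 2 * m + s ≤ 2 * n + t → m ≤ n
2*m+s≤2*n+t⇒m≤n {m} {n} {s} {t} t≤1 le = ≤-pred (*-cancelˡ-< 2 m (suc n) (begin-strict
  2 * m      ≤⟨ m≤m+n (2 * m) s ⟩
  2 * m + s  ≤⟨ le ⟩
  2 * n + t  ≤⟨ +-monoʳ-≤ (2 * n) t≤1 ⟩
  2 * n + 1  <⟨ +-monoʳ-< (2 * n) (n<1+n 1) ⟩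
  2 * n + 2  ≡⟨ +-comm (2 * n) 2 ⟩
  2 + 2 * n  ≡⟨ *-suc 2 n ⟨
  2 * suc n  ∎))
  where open ≤-Reasoning

IsOverlapRepOn : ∀ {n m} → (Fin n → Set) → Graph n → (Fin n → Subset m) → Set
IsOverlapRepOn P G S =
  (∀ {v} → P v → Nonempty (S v)) × (∀ {u v} → P u → P v → Edge G u v ⇔ Overlap (S u) (S v))

IsOverlapRepOn-mono : ∀ {n m} {P P′ : Fin n → Set} {G : Graph n} {S : Fin n → Subset m} →
                      (∀ {v} → P′ v → P v) → IsOverlapRepOn P G S → IsOverlapRepOn P′ G S
IsOverlapRepOn-mono P′⇒P (nonempty , edge⇔overlap) =
  nonempty ∘ P′⇒P , λ u∈ v∈ → edge⇔overlap (P′⇒P u∈) (P′⇒P v∈)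

IsOverlapRepOn-cong : ∀ {n m m′} {P : Fin n → Set} {G : Graph n} {S : Fin n → Subset m} {S′ : Fin n → Subset m′} →
                      (∀ {u v} → P u → P v → Alike (S u) (S v) (S′ u) (S′ v)) →
                      IsOverlapRepOn P G S → IsOverlapRepOn P G S′
IsOverlapRepOn-cong alike (nonempty , edge⇔overlap) =
  (λ v∈ → Alike⇒Nonempty (alike v∈ v∈) (nonempty v∈)) ,
  (λ u∈ v∈ → Overlap-cong (alike u∈ v∈) (alike v∈ u∈) ⇔-∘ edge⇔overlap u∈ v∈)

module LowerBound {n} {G : Graph n} (C : Components G) (q : Fin (k C) → ℕ)
  (q-optimal : ∀ i m (S : Fin (sz C i) → Subset m) → IsOverlapRep (block C i) S → q i ≤ repSize S) where

  open ComponentFacts C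

  private
    covered? : ∀ {m} K (S : Fin n → Subset m) x → Dec (∃ λ v → component v ∈ K × x ∈ S v)
    covered? K S x = any? λ v → (component v ∈? K) ×-dec (x ∈? S v)

  ⋃over : ∀ {m} → Subset (k C) → (Fin n → Subset m) → Subset m
  ⋃over K S = toSubset (covered? K S)

  ∈-⋃over : ∀ {m} {K} {S : Fin n → Subset m} {x} → x ∈ ⋃over K S ⇔ ∃ λ v → component v ∈ K × x ∈ S v
  ∈-⋃over {K = K} {S} = ∈-toSubset (covered? K S)

  ∣D∣+∣⋃over─D∣≤∣⋃over∣ : ∀ {m} {K K′} {S : Fin n → Subset m} {D} → K′ ⊆ K → D ⊆ ⋃over K S →
                          ∣ D ∣ + ∣ ⋃over K′ (λ v → S v ─ D) ∣ ≤ ∣ ⋃over K S ∣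
  ∣D∣+∣⋃over─D∣≤∣⋃over∣ {S = S} {D} K′⊆K D⊆⋃ = disjoint⇒∣p∣+∣q∣≤∣r∣ disjoint D⊆⋃ ⋃─D⊆⋃
    where
    disjoint : Empty (D ∩ ⋃over _ (λ v → S v ─ D))
    disjoint (z , z∈) with x∈p∩q⁻ D _ z∈
    ... | z∈D , z∈⋃ with to ∈-⋃over z∈⋃
    ...   | v , _ , z∈Sv─D = x∈p─q⇒x∉q {p = S v} z∈Sv─D z∈D
    ⋃─D⊆⋃ : ⋃over _ (λ v → S v ─ D) ⊆ ⋃over _ S
    ⋃─D⊆⋃ z∈ with to ∈-⋃over z∈
    ... | v , v∈K′ , z∈Sv─D = from ∈-⋃over (v , K′⊆K v∈K′ , p─q⊆p (S v) D z∈Sv─D)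

  RepOn : ∀ {m} → Subset (k C) → (Fin n → Subset m) → Set
  RepOn K = IsOverlapRepOn (λ v → component v ∈ K) G

  module _ {m} {K : Subset (k C)} {S : Fin n → Subset m} (rep : RepOn K S) where

    ⋃comp : Fin (k C) → Subset m
    ⋃comp i = ⋃over ⁅ i ⁆ S

    ∈-⋃comp⁺ : ∀ {v x} → x ∈ S v → x ∈ ⋃comp (component v)
    ∈-⋃comp⁺ {v} x∈Sv = from ∈-⋃over (v , x∈⁅x⁆ _ , x∈Sv)

    ∈-⋃comp⁻ : ∀ {i x} → x ∈ ⋃comp i → ∃ λ v → component v ≡ i × x ∈ S v
    ∈-⋃comp⁻ = map₂ (map₁ (x∈⁅y⁆⇒x≡y _)) ∘ to ∈-⋃over

    ⋃comp⊆⋃over : ∀ {i} → i ∈ K → ⋃comp i ⊆ ⋃over K S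
    ⋃comp⊆⋃over i∈K x∈ with ∈-⋃comp⁻ x∈
    ... | v , refl , x∈Sv = from ∈-⋃over (v , i∈K , x∈Sv)

    ⋃comp-nonempty : ∀ {i} → i ∈ K → Nonempty (⋃comp i)
    ⋃comp-nonempty {i} i∈K = map₂ (subst (λ j → _ ∈ ⋃comp j) (component-emb i a) ∘ ∈-⋃comp⁺)
                                  (proj₁ rep (∈-component i a i∈K))
      where a = fromℕ< (nonempty C i)

    q≤∣⋃comp∣ : ∀ {i} → i ∈ K → q i ≤ ∣ ⋃comp i ∣
    q≤∣⋃comp∣ {i} i∈K = ≤-trans (q-optimal i _ (S ∘ emb C i) blockRep) (p⊆q⇒∣p∣≤∣q∣ ⋃block⊆⋃comp)
      where
      blockRep : IsOverlapRep (block C i) (S ∘ emb C i)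
      blockRep = (λ a → proj₁ rep (∈-component i a i∈K))
               , (λ a b → proj₂ rep (∈-component i a i∈K) (∈-component i b i∈K))
      ⋃block⊆⋃comp : ⋃ (List.tabulate (S ∘ emb C i)) ⊆ ⋃comp i
      ⋃block⊆⋃comp x∈ with x∈⋃⁻ (S ∘ emb C i) x∈
      ... | a , x∈S = subst (λ j → _ ∈ ⋃comp j) (component-emb i a) (∈-⋃comp⁺ x∈S)

    nested : ∀ {u w} → component u ∈ K → component w ∈ K → component u ≢ component w →
             Nonempty (S u ∩ S w) → S u ⊆ S w ⊎ S w ⊆ S u
    nested {u} {w} u∈K w∈K u≁w meets with S u ⊆? S w | S w ⊆? S u
    ... | yes Su⊆Sw | _         = inj₁ Su⊆Sw
    ... | no _      | yes Sw⊆Su = inj₂ Sw⊆Su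
    ... | no Su⊈Sw  | no Sw⊈Su  = ⊥-elim (u≁w (Edge⇒≡ (from (proj₂ rep u∈K w∈K) (meets , Su⊈Sw , Sw⊈Su))))

    -- S x′ overlaps S x ⊆ S w, so it meets S w; of the two nestings, S w ⊆ S x′ would give S x ⊆ S x′.
    ⊆-along-path : ∀ {x y w} → Connected G x y → component x ∈ K → component w ∈ K →
                   component x ≢ component w → S x ⊆ S w → S y ⊆ S w
    ⊆-along-path ε _ _ _ Sx⊆Sw = Sx⊆Sw
    ⊆-along-path {x} {w = w} (_◅_ {j = x′} e path) x∈K w∈K x≁w Sx⊆Sw =
      ⊆-along-path path x′∈K w∈K (x≁w ∘ trans x~x′) Sx′⊆Sw
      where
      x~x′ = Edge⇒≡ e
      x′∈K = subst (_∈ K) x~x′ x∈K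
      Sx′⊆Sw : S x′ ⊆ S w
      Sx′⊆Sw with to (proj₂ rep x∈K x′∈K) e
      ... | (z , z∈) , Sx⊈Sx′ , _ with x∈p∩q⁻ (S x) (S x′) z∈
      ...   | z∈Sx , z∈Sx′ with nested x′∈K w∈K (x≁w ∘ trans x~x′) (z , x∈p∩q⁺ (z∈Sx′ , Sx⊆Sw z∈Sx))
      ...     | inj₁ Sx′⊆Sw = Sx′⊆Sw
      ...     | inj₂ Sw⊆Sx′ = ⊥-elim (Sx⊈Sx′ (Sw⊆Sx′ ∘ Sx⊆Sw))

    Su⊆Sw⇒⋃comp⊆Sw : ∀ {u w} → component u ∈ K → component w ∈ K → component u ≢ component w →
                     S u ⊆ S w → ⋃comp (component u) ⊆ S w
    Su⊆Sw⇒⋃comp⊆Sw u∈K w∈K u≁w Su⊆Sw x∈ with ∈-⋃comp⁻ x∈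
    ... | u′ , u′~u , x∈Su′ = ⊆-along-path (from Connected⇔≡ (sym u′~u)) u∈K w∈K u≁w Su⊆Sw x∈Su′

    record Minimal (i : Fin (k C)) : Set where
      field
        ∈K       : i ∈ K
        smallest : ∀ {j} → j ∈ K → ∣ ⋃comp i ∣ ≤ ∣ ⋃comp j ∣
        tie      : ∀ {j} → j ∈ K → ∣ ⋃comp i ∣ ≡ ∣ ⋃comp j ∣ → sz C i ≡ 1 → sz C j ≡ 1

    minimal : Nonempty K → ∃ Minimal
    minimal K≠∅ with argmin (λ j → 2 * ∣ ⋃comp j ∣ + tieBreak (sz C j)) K≠∅
    ... | i , i∈K , least = i , record
      { ∈K       = i∈K
      ; smallest = λ j∈K → 2*m+s≤2*n+t⇒m≤n (tieBreak≤1 _) (least j∈K)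
      ; tie      = λ j∈K eq → tieBreak-reflects-1 (+-cancelˡ-≤ _ _ _ (subst (λ s → 2 * s + _ ≤ _) eq (least j∈K)))
      }

    -- Here ⋃comp j ⊆ S u ⊆ ⋃comp i for the component j of w, and minimality of i forces equality.
    Sw⊆Su⇒⋃comp⊆Sw : ∀ {i u w} → Minimal i → component u ≡ i → component w ∈ K → component w ≢ i →
                     S w ⊆ S u → ⋃comp i ⊆ S w
    Sw⊆Su⇒⋃comp⊆Sw {u = u} {w} min refl w∈K w≁u Sw⊆Su = byCases (sz C (component w) ≟ 1)
      where
      Uj⊆Su : ⋃comp (component w) ⊆ S u
      Uj⊆Su = Su⊆Sw⇒⋃comp⊆Sw w∈K (Minimal.∈K min) w≁u Sw⊆Su
      Uj⊆Ui : ⋃comp (component w) ⊆ ⋃comp (component u)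
      Uj⊆Ui = ∈-⋃comp⁺ ∘ Uj⊆Su
      Ui⊆Uj : ⋃comp (component u) ⊆ ⋃comp (component w)
      Ui⊆Uj = p⊆q∧∣q∣≤∣p∣⇒q⊆p Uj⊆Ui (Minimal.smallest min w∈K)
      ∣Ui∣≡∣Uj∣ : ∣ ⋃comp (component u) ∣ ≡ ∣ ⋃comp (component w) ∣
      ∣Ui∣≡∣Uj∣ = ≤-antisym (Minimal.smallest min w∈K) (p⊆q⇒∣p∣≤∣q∣ Uj⊆Ui)
      byCases : Dec (sz C (component w) ≡ 1) → ⋃comp (component u) ⊆ S w
      byCases (yes size≡1) x∈Ui with ∈-⋃comp⁻ (Ui⊆Uj x∈Ui)
      ... | v , v~w , x∈Sv = subst (λ v′ → _ ∈ S v′) (singleton v~w size≡1) x∈Sv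
      byCases (no size≢1) with neighbour u (size≢1 ∘ Minimal.tie min w∈K ∣Ui∣≡∣Uj∣)
      ... | u′ , e with to (proj₂ rep (Minimal.∈K min) (subst (_∈ K) (Edge⇒≡ e) (Minimal.∈K min))) e
      ...   | _ , _ , Su′⊈Su =
        ⊥-elim (Su′⊈Su (Uj⊆Su ∘ Ui⊆Uj ∘ subst (λ c → _ ∈ ⋃comp c) (sym (Edge⇒≡ e)) ∘ ∈-⋃comp⁺))

    meets⇒⋃comp⊆Sw : ∀ {i u w} → Minimal i → component u ≡ i → component w ∈ K → component w ≢ i →
                     Nonempty (S u ∩ S w) → ⋃comp i ⊆ S w
    meets⇒⋃comp⊆Sw min refl w∈K w≁u meets with nested (Minimal.∈K min) w∈K (w≁u ∘ sym) meets
    ... | inj₁ Su⊆Sw = Su⊆Sw⇒⋃comp⊆Sw (Minimal.∈K min) w∈K (w≁u ∘ sym) Su⊆Sw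
    ... | inj₂ Sw⊆Su = Sw⊆Su⇒⋃comp⊆Sw min refl w∈K w≁u Sw⊆Su

    containsOrAvoids : ∀ {i w} → Minimal i → component w ∈ K → component w ≢ i → ContainsOrAvoids (⋃comp i) (S w)
    containsOrAvoids {i} {w} min w∈K w≁i with nonempty? (S w ∩ ⋃comp i)
    ... | no disjoint = inj₂ λ z∈Sw z∈Ui → disjoint (_ , x∈p∩q⁺ (z∈Sw , z∈Ui))
    ... | yes (z , z∈) with x∈p∩q⁻ (S w) _ z∈
    ...   | z∈Sw , z∈Ui with ∈-⋃comp⁻ z∈Ui
    ...     | u , u~i , z∈Su = inj₁ (meets⇒⋃comp⊆Sw min u~i w∈K w≁i (z , x∈p∩q⁺ (z∈Su , z∈Sw)))

    removeComponent : ∀ {i x} → Minimal i → x ∈ ⋃comp i → RepOn (K - i) (λ v → S v ─ (⋃comp i - x))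
    removeComponent {i} min x∈Ui =
      IsOverlapRepOn-cong {G = G} (λ u∈ v∈ → Alike-─ x∈Ui (settled u∈) (settled v∈))
                                  (IsOverlapRepOn-mono {G = G} (p─q⊆p K _) rep)
      where
      settled : ∀ {v} → component v ∈ K - i → ContainsOrAvoids (⋃comp i) (S v)
      settled v∈ = containsOrAvoids min (p─q⊆p K _ v∈)
                     λ v~i → x∈p─q⇒x∉q {p = K} v∈ (subst (_∈ ⁅ i ⁆) (sym v~i) (x∈⁅x⁆ i))

  sumOver-pred<∣⋃over∣ : ∀ {m K} → Acc _⊂_ K → {S : Fin n → Subset m} → RepOn K S → Nonempty K →
                         sumOver K (pred ∘ q) < ∣ ⋃over K S ∣
  sumOver-pred<∣⋃over∣ {K = K} (acc rec) {S} rep K≠∅ =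
    let i , min = minimal rep K≠∅ in removeMinimal min (proj₂ (⋃comp-nonempty rep (Minimal.∈K min)))
    where
    p = pred ∘ q
    removeMinimal : ∀ {i x} → Minimal rep i → x ∈ ⋃comp rep i → sumOver K p < ∣ ⋃over K S ∣
    removeMinimal {i} {x} min x∈Ui = byCases (nonempty? (K - i))
      where
      open ≤-Reasoning
      i∈K = Minimal.∈K min
      D = ⋃comp rep i - x
      pi≤∣D∣ : p i ≤ ∣ D ∣
      pi≤∣D∣ = pred-mono-≤ (≤-trans (q≤∣⋃comp∣ rep i∈K) (≤-reflexive (x∈p⇒∣p∣≡1+∣p-x∣ x∈Ui)))
      byCases : Dec (Nonempty (K - i)) → sumOver K p < ∣ ⋃over K S ∣
      byCases (yes K-i≠∅) = begin-strict
        sumOver K p                                ≡⟨ sumOver-remove p i∈K ⟩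
        p i + sumOver (K - i) p                    <⟨ +-mono-≤-< pi≤∣D∣ IH ⟩
        ∣ D ∣ + ∣ ⋃over (K - i) (λ v → S v ─ D) ∣  ≤⟨ ∣D∣+∣⋃over─D∣≤∣⋃over∣ (p─q⊆p K _) D⊆⋃over ⟩
        ∣ ⋃over K S ∣                              ∎
        where
        IH = sumOver-pred<∣⋃over∣ (rec (x∈p⇒p-x⊂p i∈K)) (removeComponent rep min x∈Ui) K-i≠∅
        D⊆⋃over : D ⊆ ⋃over K S
        D⊆⋃over = ⋃comp⊆⋃over rep i∈K ∘ p─q⊆p _ _
      byCases (no K-i≡∅) = begin-strict
        sumOver K p              ≡⟨ sumOver-remove p i∈K ⟩
        p i + sumOver (K - i) p  ≡⟨ cong (λ K′ → p i + sumOver K′ p) (Empty-unique K-i≡∅) ⟩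
        p i + sumOver ⊥ p        ≡⟨ cong (p i +_) (sumOver-⊥ p) ⟩
        p i + 0                  ≡⟨ +-identityʳ _ ⟩
        p i                      ≤⟨ pi≤∣D∣ ⟩
        ∣ D ∣                    <⟨ n<1+n _ ⟩
        suc ∣ D ∣                ≡⟨ x∈p⇒∣p∣≡1+∣p-x∣ x∈Ui ⟨
        ∣ ⋃comp rep i ∣          ≤⟨ p⊆q⇒∣p∣≤∣q∣ (⋃comp⊆⋃over rep i∈K) ⟩
        ∣ ⋃over K S ∣            ∎

  sumFin-pred<repSize : Fin (k C) → ∀ m (S : Fin n → Subset m) → IsOverlapRep G S → sumFin (pred ∘ q) < repSize S
  sumFin-pred<repSize i m S (nonempty , edge⇔overlap) = begin-strict
    sumFin (pred ∘ q)     ≡⟨ sumOver-⊤ (pred ∘ q) ⟨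
    sumOver ⊤ (pred ∘ q)  <⟨ sumOver-pred<∣⋃over∣ (⊂-wellFounded ⊤) repOn⊤ (i , ∈⊤) ⟩
    ∣ ⋃over ⊤ S ∣         ≤⟨ p⊆q⇒∣p∣≤∣q∣ (λ x∈ → let v , _ , x∈Sv = to ∈-⋃over x∈ in x∈⋃⁺ S v x∈Sv) ⟩
    repSize S             ∎
    where
    open ≤-Reasoning
    repOn⊤ : RepOn ⊤ S
    repOn⊤ = (λ _ → nonempty _) , λ _ _ → edge⇔overlap _ _

-- Gluing representations of the components

data SplitView (m n : ℕ) : Fin (m + n) → Set where
  left  : (x : Fin m) → SplitView m n (x ↑ˡ n)
  right : (y : Fin n) → SplitView m n (m ↑ʳ y)

splitView : ∀ m n (z : Fin (m + n)) → SplitView m n z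
splitView zero    n z       = right z
splitView (suc m) n zero    = left zero
splitView (suc m) n (suc z) with splitView m n z
... | left x  = left (suc x)
... | right y = right y

∈-++ˡ : ∀ {m n} {a : Subset m} {b : Subset n} {x} → x ↑ˡ n ∈ a ++ b ⇔ x ∈ a
∈-++ˡ {a = a} {b} {x} = ∈-lookup-cong (lookup-++ˡ a b x)

∈-++ʳ : ∀ {m n} {a : Subset m} {b : Subset n} {y} → m ↑ʳ y ∈ a ++ b ⇔ y ∈ b
∈-++ʳ {a = a} {b} {y} = ∈-lookup-cong (lookup-++ʳ a b y)

∈-⊥++ : ∀ {m M} {Y : Subset M} {z} → z ∈ ⊥ {m} ++ Y → ∃ λ y → z ≡ m ↑ʳ y × y ∈ Y
∈-⊥++ {m} {M} {z = z} z∈ with splitView m M z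
... | left x  = ⊥-elim (∉⊥ (to ∈-++ˡ z∈))
... | right y = y , refl , to ∈-++ʳ z∈

Alike-⊥++ : ∀ {m M} {A B : Subset M} → Alike A B (⊥ {m} ++ A) (⊥ {m} ++ B)
Alike-⊥++ {m} {A = A} {B} = record
  { meet = mk⇔ (λ (y , y∈A∩B) → m ↑ʳ y , x∈p∩q⁺ (map (from ∈-++ʳ) (from ∈-++ʳ) (x∈p∩q⁻ A B y∈A∩B))) meet⁻
  ; incl = mk⇔ incl⁺ (λ ⊆′ → to ∈-++ʳ ∘ ⊆′ ∘ from ∈-++ʳ)
  }
  where
  meet⁻ : Nonempty ((⊥ {m} ++ A) ∩ (⊥ ++ B)) → Nonempty (A ∩ B)
  meet⁻ (z , z∈) with x∈p∩q⁻ (⊥ {m} ++ A) (⊥ ++ B) z∈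
  ... | z∈⊥++A , z∈⊥++B with ∈-⊥++ {m} z∈⊥++A
  ...   | y , refl , y∈A = y , x∈p∩q⁺ (y∈A , to ∈-++ʳ z∈⊥++B)
  incl⁺ : A ⊆ B → ⊥ {m} ++ A ⊆ ⊥ ++ B
  incl⁺ A⊆B z∈ with ∈-⊥++ {m} z∈
  ... | y , refl , y∈A = from ∈-++ʳ (A⊆B y∈A)

collapse : ∀ {s M} → Fin (s + M) → Fin (suc s)
collapse {s} z = [ suc , (λ _ → zero) ]′ (splitAt s z)

collapse-↑ˡ : ∀ {s M} (x : Fin s) → collapse (x ↑ˡ M) ≡ suc x
collapse-↑ˡ {s} {M} x = cong [ suc , (λ _ → zero) ]′ (splitAt-↑ˡ s x M)

collapse-↑ʳ : ∀ {s M} (y : Fin M) → collapse (s ↑ʳ y) ≡ zero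
collapse-↑ʳ {s} {M} y = cong [ suc , (λ _ → zero) ]′ (splitAt-↑ʳ s M y)

-- absorb A replaces the point 0 of A's universe by a block of M new points.  The empty universe
-- gets a junk value; it never occurs, as universes of overlap representations are nonempty.
absorb : ∀ {s M} → Subset s → Subset (pred s + M)
absorb {zero}  _ = ⊥
absorb {suc s} A = collapse ⁻¹[ A ]

∈-absorb-↑ʳ : ∀ {s M} {A : Subset (suc s)} {y : Fin M} → s ↑ʳ y ∈ absorb A ⇔ zero ∈ A
∈-absorb-↑ʳ {s} {A = A} {y} = subst (λ x → s ↑ʳ y ∈ absorb A ⇔ x ∈ A) (collapse-↑ʳ y) (∈-⁻¹ collapse)

Alike-absorb : ∀ {s M} → Fin M → {A B : Subset s} → Alike A B (absorb {M = M} A) (absorb B)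
Alike-absorb {zero} _ {[]} {[]} = record
  { meet = mk⇔ (λ { (() , _) }) (λ (z , z∈) → ⊥-elim (∉⊥ (proj₁ (x∈p∩q⁻ ⊥ ⊥ z∈))))
  ; incl = mk⇔ (λ _ {_} z∈ → z∈) (λ _ {x} ())
  }
Alike-absorb {suc s} {M} y₀ = Alike-pullback collapse (∈-⁻¹ collapse) (∈-⁻¹ collapse) onto
  where
  onto : ∀ {A : Subset (suc s)} {x} → x ∈ A → ∃ λ z → collapse z ≡ x
  onto {x = zero}  _ = s ↑ʳ y₀ , collapse-↑ʳ y₀
  onto {x = suc x} _ = x ↑ˡ M  , collapse-↑ˡ x

absorb-covers : ∀ {s M} {I : Set} (F : I → Subset s) → (∀ x → ∃ λ b → x ∈ F b) →
                ∀ x → ∃ λ b → x ↑ˡ M ∈ absorb (F b)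
absorb-covers {suc s} F covers x with covers (suc x)
... | b , sx∈ = b , from (∈-⁻¹ collapse) (subst (_∈ F b) (sym (collapse-↑ˡ x)) sx∈)

⊥++⊆absorb : ∀ {s M} {A : Subset (suc s)} {Y : Subset M} → zero ∈ A → ⊥ {s} ++ Y ⊆ absorb A
⊥++⊆absorb {s} 0∈A z∈ with ∈-⊥++ {s} z∈
... | y , refl , _ = from ∈-absorb-↑ʳ 0∈A

-- A common point lies in the absorbing block, so 0 ∈ A and the whole block lies in absorb A.
absorb-⊥++-nonoverlapping : ∀ {s M} (A : Subset s) (Y : Subset M) → ¬ Overlap (absorb A) (⊥ {pred s} ++ Y)
absorb-⊥++-nonoverlapping {zero}  A Y ((z , z∈) , _) = ∉⊥ (proj₁ (x∈p∩q⁻ ⊥ _ z∈))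
absorb-⊥++-nonoverlapping {suc s} A Y ((z , z∈) , _ , ⊥++Y⊈absorbA) with x∈p∩q⁻ (absorb A) _ z∈
... | z∈absorbA , z∈⊥++Y with ∈-⊥++ {s} z∈⊥++Y
...   | y , refl , _ = ⊥++Y⊈absorbA (⊥++⊆absorb {A = A} (to (∈-absorb-↑ʳ {s} {A = A}) z∈absorbA))

glueSize : ∀ {k} → (Fin k → ℕ) → ℕ
glueSize {zero}        q = 0
glueSize {suc zero}    q = q zero
glueSize {suc (suc k)} q = pred (q zero) + glueSize (q ∘ suc)

-- Component j gets ⊥ on the private points of the earlier components, and the point 0 of every
-- universe but the last is absorbed into the block of all later components.
glue : ∀ {k} (q : Fin k → ℕ) (j : Fin k) → Subset (q j) → Subset (glueSize q)
glue {suc zero}    q zero    A = A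
glue {suc (suc k)} q zero    A = absorb A
glue {suc (suc k)} q (suc j) A = ⊥ ++ glue (q ∘ suc) j A

glueSize-point : ∀ {k} (q : Fin (suc k) → ℕ) → (∀ j → 0 < q j) → Fin (glueSize q)
glueSize-point {zero}  q q>0 = fromℕ< (q>0 zero)
glueSize-point {suc k} q q>0 = pred (q zero) ↑ʳ glueSize-point (q ∘ suc) (q>0 ∘ suc)

Alike-glue : ∀ {k} (q : Fin k → ℕ) → (∀ j → 0 < q j) → ∀ j {A B} → Alike A B (glue q j A) (glue q j B)
Alike-glue {suc zero}    q q>0 zero    = Alike-refl
Alike-glue {suc (suc k)} q q>0 zero    = Alike-absorb (glueSize-point (q ∘ suc) (q>0 ∘ suc))
Alike-glue {suc (suc k)} q q>0 (suc j) = Alike-trans (Alike-glue (q ∘ suc) (q>0 ∘ suc) j) Alike-⊥++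

glue-nonoverlapping : ∀ {k} (q : Fin k → ℕ) {j l} → j ≢ l → ∀ A B → ¬ Overlap (glue q j A) (glue q l B)
glue-nonoverlapping {suc zero}    q {zero}  {zero}  j≢l _ _ = ⊥-elim (j≢l refl)
glue-nonoverlapping {suc (suc k)} q {zero}  {zero}  j≢l _ _ = ⊥-elim (j≢l refl)
glue-nonoverlapping {suc (suc k)} q {zero}  {suc l} _   A _ = absorb-⊥++-nonoverlapping A _
glue-nonoverlapping {suc (suc k)} q {suc j} {zero}  _   _ B = absorb-⊥++-nonoverlapping B _ ∘ Overlap-sym
glue-nonoverlapping {suc (suc k)} q {suc j} {suc l} j≢l A B =
  glue-nonoverlapping (q ∘ suc) (j≢l ∘ cong suc) A B ∘ from (Overlap-cong Alike-⊥++ Alike-⊥++)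

GlueCovers : ∀ {k} (q : Fin k → ℕ) {I : Fin k → Set} → (∀ j → I j → Subset (q j)) → Set
GlueCovers q F = ∀ z → ∃ λ j → ∃ λ b → z ∈ glue q j (F j b)

GlueCovers-step : ∀ {k} (q : Fin (suc (suc k)) → ℕ) {I : Fin (suc (suc k)) → Set} (F : ∀ j → I j → Subset (q j)) →
                  (∀ x → ∃ λ b → x ∈ F zero b) → GlueCovers (q ∘ suc) (F ∘ suc) → GlueCovers q F
GlueCovers-step q F covers₀ coversRest z with splitView (pred (q zero)) (glueSize (q ∘ suc)) z
... | left x  = zero , absorb-covers (F zero) covers₀ x
... | right y with coversRest y
...   | j , b , y∈ = suc j , b , from ∈-++ʳ y∈

glue-covers : ∀ {k} (q : Fin k → ℕ) {I : Fin k → Set} (F : ∀ j → I j → Subset (q j)) →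
              (∀ j x → ∃ λ b → x ∈ F j b) → GlueCovers q F
glue-covers {suc zero}    q F covers z = zero , covers zero z
glue-covers {suc (suc k)} q F covers   =
  GlueCovers-step q F (covers zero) (glue-covers (q ∘ suc) (F ∘ suc) (covers ∘ suc))

Fin⇒0< : ∀ {m} → Fin m → 0 < m
Fin⇒0< zero    = s≤s z≤n
Fin⇒0< (suc _) = s≤s z≤n

module Gluing {n} {G : Graph n} (C : Components G) (O : ∀ i → OptimalRep (block C i)) where

  open ComponentFacts C
  open OptimalRep

  q : Fin (k C) → ℕ
  q i = size (O i)

  R : ∀ i → Fin (sz C i) → Subset (q i)
  R i = lookup (sets (O i))

  q>0 : ∀ i → 0 < q i
  q>0 i = Fin⇒0< (proj₁ (proj₁ (isRep (O i)) (fromℕ< (nonempty C i))))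

  glued : Fin n → Subset (glueSize q)
  glued v = glue q (component v) (R (component v) (position v))

  glued-emb : ∀ i a → glued (emb C i a) ≡ glue q i (R i a)
  glued-emb i a = cong (λ (j , b) → glue q j (R j b)) (position-emb i a)

  glued-isRep : IsOverlapRep G glued
  glued-isRep = (λ v → Alike⇒Nonempty (Alike-glue q q>0 _) (proj₁ (isRep (O _)) (position v))) , edge⇔overlap
    where
    within : ∀ {i j} (a : Fin (sz C i)) (b : Fin (sz C j)) → i ≡ j →
             Edge G (emb C i a) (emb C j b) ⇔ Overlap (glue q i (R i a)) (glue q j (R j b))
    within a b refl = Overlap-cong (Alike-glue q q>0 _) (Alike-glue q q>0 _) ⇔-∘ proj₂ (isRep (O _)) a b
    edge⇔overlap : ∀ u v → Edge G u v ⇔ Overlap (glued u) (glued v)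
    edge⇔overlap u v with component u ≟ᶠ component v
    ... | yes u~v = subst₂ (λ u′ v′ → Edge G u′ v′ ⇔ Overlap (glued u) (glued v)) (emb-position u) (emb-position v)
                           (within (position u) (position v) u~v)
    ... | no u≁v  = mk⇔ (⊥-elim ∘ u≁v ∘ Edge⇒≡) (⊥-elim ∘ glue-nonoverlapping q u≁v _ _)

  glued-covers : Covers glued
  glued-covers z with glue-covers q R (covers ∘ O) z
  ... | j , b , z∈ = emb C j b , subst (z ∈_) (sym (glued-emb j b)) z∈

sumFin≡k+sumFin-pred : ∀ {k} (q : Fin k → ℕ) → (∀ j → 0 < q j) → sumFin q ≡ k + sumFin (pred ∘ q)
sumFin≡k+sumFin-pred {zero}  q q>0 = refl
sumFin≡k+sumFin-pred {suc k} q q>0 with q zero | q>0 zero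
... | suc p | _ = cong suc (trans (cong (p +_) (sumFin≡k+sumFin-pred (q ∘ suc) (q>0 ∘ suc))) (x∙yz≈y∙xz p k _))

sumFin∸≡1+sumFin-pred : ∀ {k} → Fin k → (q : Fin k → ℕ) → (∀ j → 0 < q j) →
                        sumFin q ∸ (k ∸ 1) ≡ suc (sumFin (pred ∘ q))
sumFin∸≡1+sumFin-pred {suc k} _ q q>0 = begin
  sumFin q ∸ k                     ≡⟨ cong (_∸ k) (sumFin≡k+sumFin-pred q q>0) ⟩
  suc k + sumFin (pred ∘ q) ∸ k    ≡⟨ cong (_∸ k) (+-suc k _) ⟨
  k + suc (sumFin (pred ∘ q)) ∸ k  ≡⟨ m+n∸m≡n k _ ⟩
  suc (sumFin (pred ∘ q))          ∎
  where open ≡-Reasoning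

glueSize≡1+sumFin-pred : ∀ {k} → Fin k → (q : Fin k → ℕ) → (∀ j → 0 < q j) →
                         glueSize q ≡ suc (sumFin (pred ∘ q))
glueSize≡1+sumFin-pred {suc zero} _ q q>0 with q zero | q>0 zero
... | suc p | _ = cong suc (sym (+-identityʳ p))
glueSize≡1+sumFin-pred {suc (suc k)} _ q q>0 =
  trans (cong (pred (q zero) +_) (glueSize≡1+sumFin-pred zero (q ∘ suc) (q>0 ∘ suc))) (+-suc _ _)

theorem17 : ∀ n → 0 < n → (G : Graph n) → (C : Components G) →
    Σ (Fin (k C) → ℕ) λ q →
    (∀ i → IsOverlapNumber (block C i) (q i)) ×
    IsOverlapNumber G (sumFin q ∸ (k C ∸ 1))
theorem17 n 0<n G C =
  q , (λ i → isOverlapNumber (O i)) ,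
  subst (IsOverlapNumber G) (sym (sumFin∸≡1+sumFin-pred i₀ q q>0))
    ((glueSize q , glued , glued-isRep , size≡) , LowerBound.sumFin-pred<repSize C q (λ i → optimal (O i)) i₀)
  where
  O : ∀ i → OptimalRep (block C i)
  O i = optimalRep (block C i)
  open OptimalRep using (isOverlapNumber; optimal)
  open Gluing C O
  i₀ = ComponentFacts.component C (fromℕ< 0<n)
  size≡ : repSize glued ≡ suc (sumFin (pred ∘ q))
  size≡ = trans (Covers⇒repSize≡ glued glued-covers) (glueSize≡1+sumFin-pred i₀ q q>0)
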